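{- Let $L=(X,\le)$ be a finite lattice with set of meet-irreducibles $M$. If $L$ is generated by a Chip Firing Game whose support graph is a directed acyclic multigraph, then the directed graph $\mathcal{G}$ is acyclic.
   Context: $x\prec y$ means $y$ covers $x$; $M$ is the set of elements with exactly one upper cover, $M_x=\{m\in M:x\le m\}$. Lattices generated by Chip Firing Games are upper locally distributive, so for each cover $x\prec y$ the set $M_x\setminus M_y$ has exactly one element $\mathfrak{m}(x,y)$. For $m\in M$, $\mathfrak{U}_m$ is the set of minimal elements of $\{x\in X:\exists y,\ x\prec y,\ \mathfrak{m}(x,y)=m\}$. $\mathcal{G}$ is the simple directed graph with vertex set $M$ and an edge $(m_1,m_2)$ iff $m_1\in\bigcup_{a\in\mathfrak{U}_{m_2}}(M\setminus M_a)$. Chip Firing Games: $G$ a finite directed multigraph with out-degrees $deg^{+}(v)$; a sink is a vertex all of whose outgoing edges are loops. Configurations are maps $V(G)\to\mathbb{N}$; a non-sink $v$ is firable in $c$ if $c(v)\ge deg^{+}(v)$, and firing moves one chip from $v$ along each outgoing edge. $CFG(G,\mathcal{O})$ is the set of configurations reachable from $\mathcal{O}$, ordered by reachability; when no infinite firing sequence exists (e.g. $G$ acyclic) it is a lattice, and lattices isomorphic to it are said to be generated by the game. An acyclic graph has no directed cycles. -}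

module Defs where

open import Level using (0ℓ)
open import Data.Nat as ℕ using (ℕ; _+_; _<_)
import Data.Nat as N
open import Data.Fin using (Fin)
open import Data.List using (List; map; allFin)
open import Data.Nat.ListAction using (sum)
open import Data.Product using (Σ; ∃; ∃-syntax; _×_; _,_)
open import Data.Sum using (_⊎_)
open import Relation.Nullary using (¬_)
open import Relation.Binary.Core using (Rel)
open import Relation.Binary.PropositionalEquality using (_≡_; _≢_; _≗_)
open import Relation.Binary.Construct.Closure.Transitive using (TransClosure)
open import Relation.Binary.Construct.Closure.ReflexiveTransitive using (Star)
open import Function.Bundles using (_⇔_)

module OrderNotions {n : ℕ} (_≤_ : Rel (Fin n) 0ℓ) where

  _≺_ : Fin n → Fin n → Set
  x ≺ y = (x ≤ y) × (x ≢ y) ×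
          (∀ z → x ≤ z → z ≤ y → (z ≡ x) ⊎ (z ≡ y))

  InM : Fin n → Set
  InM m = ∃[ y ] ((m ≺ y) × (∀ y′ → m ≺ y′ → y′ ≡ y))

  InMx : Fin n → Fin n → Set
  InMx x m = InM m × (x ≤ m)

  -- 𝔪(x,y) = m : m is the (in ULD lattices unique) element of M_x ∖ M_y
  IsMfrak : Fin n → Fin n → Fin n → Set
  IsMfrak x y m = InMx x m × ¬ InMx y m

  InS : Fin n → Fin n → Set
  InS m x = ∃[ y ] ((x ≺ y) × IsMfrak x y m)

  InU : Fin n → Fin n → Set
  InU m a = InS m a × (∀ x → InS m x → x ≤ a → x ≡ a)

  GEdge : Fin n → Fin n → Set
  GEdge m₁ m₂ = InM m₁ × InM m₂ × (∃[ a ] (InU m₂ a × ¬ InMx a m₁))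

  GAcyclic : Set
  GAcyclic = ∀ m → ¬ TransClosure GEdge m m

-- Chip Firing Games on a finite directed multigraph with vertices Fin k.
-- A multigraph is given by edge multiplicities: mult u v = number of
-- edges from u to v (loops allowed).

Multigraph : ℕ → Set
Multigraph k = Fin k → Fin k → ℕ

module CFG {k : ℕ} (G : Multigraph k) where

  outdeg : Fin k → ℕ
  outdeg v = sum (map (G v) (allFin k))

  Sink : Fin k → Set
  Sink v = ∀ w → w ≢ v → G v w ≡ 0

  Config : Set
  Config = Fin k → ℕ

  Firable : Config → Fin k → Set
  Firable c v = ¬ Sink v × (outdeg v N.≤ c v)

  Fire : Fin k → Config → Config → Set
  Fire v c c′ = Firable c v ×
    (∀ w → (w ≡ v → c′ w + outdeg v ≡ c w + G v w) ×
           (w ≢ v → c′ w ≡ c w + G v w))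

  Step : Config → Config → Set
  Step c c′ = ∃[ v ] Fire v c c′

  _⟶*_ : Config → Config → Set
  _⟶*_ = Star Step

  -- the support graph has no directed cycle (a loop counts as a cycle)
  Edge : Fin k → Fin k → Set
  Edge u v = 0 < G u v

  Acyclic : Set
  Acyclic = ∀ v → ¬ TransClosure Edge v v

-- The poset (Fin n, ≤) is isomorphic to CFG(G,O) ordered by reachability:
-- f maps into the reachable configurations, is surjective onto them (up to
-- pointwise equality of configurations) and is an order embedding.
GeneratedBy : {n : ℕ} → Rel (Fin n) 0ℓ → {k : ℕ} → Multigraph k →
              (Fin k → ℕ) → Set
GeneratedBy {n} _≤_ G O =
  Σ (Fin n → Config) λ f →
    (∀ x → O ⟶* f x) ×
    (∀ c → O ⟶* c → ∃[ x ] (f x ≗ c)) ×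
    (∀ x y → (x ≤ y) ⇔ (f x ⟶* f y))
  where open CFG G

module Submission where

-- The shot vector σ x of x ∈ L counts how often each vertex fired on the
-- way to x.  As G is acyclic, σ x is independent of the firing sequence, the
-- order of L is the pointwise order of shot vectors, and covers x ≺ y are
-- single firings σ y = σ x + δ w; so a meet-irreducible m has exactly one
-- firable vertex v(m).  Key lemma: an edge m₁ → m₂ of 𝒢 forces v(m₁) to be a
-- proper ancestor of v(m₂) in G, or v(m₁) = v(m₂) with fewer shots at m₁.
-- That relation on pairs (vertex, shot count) is a strict order, so 𝒢 has no
-- cycle.  (The goal is a negation, so the key lemma may be proved under ¬¬,
-- treating ancestry in G as decidable.)  The file develops, in order: finite
-- sums and unit vectors; the dynamics of an acyclic game (conservation law,
-- uniqueness of shot vectors, reachability from shot vectors, restriction to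
-- an ancestor-closed set); the lattice/shot-vector dictionary; the key lemma.

open import Defs
open import Level using (0ℓ)
open import Data.Nat using (ℕ; zero; suc; _+_; _*_; _∸_; _≤_; _<_; z≤n; s≤s; s≤s⁻¹)
open import Data.Nat.Properties renaming (_≟_ to _≟ℕ_)
open import Data.Nat.Tactic.RingSolver using (solve-∀)
open import Data.Fin as Fin using (Fin; zero; suc)
open import Data.Fin.Properties using (_≟_; pigeonhole; ¬∀⟶∃¬; all?)
open import Data.List using (map; tabulate)
open import Data.Nat.ListAction using (sum)
open import Data.Product using (Σ; ∃-syntax; _×_; _,_; proj₁; proj₂)
open import Data.Sum using (_⊎_; inj₁; inj₂)
open import Data.Empty using (⊥; ⊥-elim)
open import Function using (_∘_; id)
open import Function.Bundles using (_⇔_; Equivalence)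
open import Algebra.Core using (Op₂)
open import Relation.Nullary using (¬_; Dec; yes; no)
open import Relation.Nullary.Decidable using (¬¬-excluded-middle)
open import Relation.Binary.Core using (Rel)
open import Relation.Binary.Structures using (IsPartialOrder)
open import Relation.Binary.Lattice.Definitions using (Infimum)
open import Relation.Binary.Lattice.Structures using (IsLattice)
open import Relation.Binary.PropositionalEquality
open import Relation.Binary.Construct.Closure.Transitive using (TransClosure; [_]; _∷_)
  renaming (_++_ to _++⁺_)
open import Relation.Binary.Construct.Closure.ReflexiveTransitive using (Star; ε; _◅_; _◅◅_)

_≤ᵛ_ : ∀ {k} → (Fin k → ℕ) → (Fin k → ℕ) → Set
s ≤ᵛ t = ∀ u → s u ≤ t u

pointwise? : ∀ {k} (s t : Fin k → ℕ) → Dec (s ≗ t)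
pointwise? s t = all? (λ u → s u ≟ℕ t u)

strictly-somewhere : ∀ {k} {s t : Fin k → ℕ} → s ≤ᵛ t → ¬ (s ≗ t) → ∃[ u ] (s u < t u)
strictly-somewhere {k} {s} {t} s≤t s≉t =
  let (u , sᵤ≢tᵤ) = ¬∀⟶∃¬ k _ (λ u → s u ≟ℕ t u) s≉t in u , ≤∧≢⇒< (s≤t u) sᵤ≢tᵤ

δ : ∀ {k} → Fin k → Fin k → ℕ
δ zero    zero    = 1
δ zero    (suc _) = 0
δ (suc _) zero    = 0
δ (suc v) (suc u) = δ v u

δ-same : ∀ {k} (v : Fin k) → δ v v ≡ 1
δ-same zero    = refl
δ-same (suc v) = δ-same v

δ-other : ∀ {k} (v u : Fin k) → v ≢ u → δ v u ≡ 0
δ-other zero    zero    v≢u = ⊥-elim (v≢u refl)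
δ-other zero    (suc u) v≢u = refl
δ-other (suc v) zero    v≢u = refl
δ-other (suc v) (suc u) v≢u = δ-other v u (v≢u ∘ cong suc)

+δ-same : ∀ {k} (s : Fin k → ℕ) v → s v + δ v v ≡ suc (s v)
+δ-same s v = trans (cong (s v +_) (δ-same v)) (+-comm (s v) 1)

+δ-other : ∀ {k} (s : Fin k → ℕ) {v u} → v ≢ u → s u + δ v u ≡ s u
+δ-other s {v} {u} v≢u = trans (cong (s u +_) (δ-other v u v≢u)) (+-identityʳ (s u))

_≐_+δ_ : ∀ {k} → (Fin k → ℕ) → (Fin k → ℕ) → Fin k → Set
t ≐ s +δ w = ∀ u → t u ≡ s u + δ w u

≐⇒≤ᵛ : ∀ {k} (s : Fin k → ℕ) w {t} → t ≐ s +δ w → s ≤ᵛ t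
≐⇒≤ᵛ s w t≐s+δ u = subst (s u ≤_) (sym (t≐s+δ u)) (m≤m+n _ _)

one-more-at : ∀ {k} (s : Fin k → ℕ) w {t} → t ≐ s +δ w → s w < t w
one-more-at s w t≐s+δ = subst (s w <_) (sym (trans (t≐s+δ w) (+δ-same s w))) (n<1+n _)

+δ-injective : ∀ {k} (s : Fin k → ℕ) w w′ {t} → t ≐ s +δ w → t ≐ s +δ w′ → w ≡ w′
+δ-injective s w w′ t₁ t₂ with w′ ≟ w
... | yes w′≡w = sym w′≡w
... | no  w′≢w = ⊥-elim (1+n≢n (trans (sym (+δ-same s w))
                   (trans (sym (t₁ w)) (trans (t₂ w) (+δ-other s w′≢w)))))

squeezed-at : ∀ {k} {s t : Fin k → ℕ} {w v} → s v ≤ t v → t v < s v + δ w v →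
              w ≡ v × s v ≡ t v
squeezed-at {s = s} {t} {w} {v} sᵥ≤tᵥ tᵥ<sᵥ+δ with w ≟ v
... | no  w≢v = ⊥-elim (<⇒≱ (subst (t v <_) (+δ-other s w≢v) tᵥ<sᵥ+δ) sᵥ≤tᵥ)
... | yes refl = refl , ≤-antisym sᵥ≤tᵥ (s≤s⁻¹ (subst (t v <_) (+δ-same s v) tᵥ<sᵥ+δ))

squeeze : ∀ {k} {s t : Fin k → ℕ} w → s ≤ᵛ t → (∀ u → t u ≤ s u + δ w u) →
          (t ≗ s) ⊎ (t ≐ s +δ w)
squeeze {s = s} {t} w s≤t t≤s+δ with t w ≟ℕ s w
... | yes tw≡sw = inj₁ at-s
  where
  at-s : t ≗ s
  at-s u with w ≟ u
  ... | yes refl = tw≡sw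
  ... | no  w≢u  = ≤-antisym (subst (t u ≤_) (+δ-other s w≢u) (t≤s+δ u)) (s≤t u)
... | no tw≢sw = inj₂ at-s+δ
  where
  at-s+δ : t ≐ s +δ w
  at-s+δ u with w ≟ u
  ... | yes refl = ≤-antisym (t≤s+δ u)
                     (subst (_≤ t u) (sym (+δ-same s u)) (≤∧≢⇒< (s≤t u) (tw≢sw ∘ sym)))
  ... | no  w≢u  = trans (≤-antisym (subst (t u ≤_) (+δ-other s w≢u) (t≤s+δ u)) (s≤t u))
                     (sym (+δ-other s w≢u))

∑ : (k : ℕ) → (Fin k → ℕ) → ℕ
∑ zero    f = 0
∑ (suc k) f = f zero + ∑ k (f ∘ suc)

sum-map-tabulate : ∀ {A : Set} k (g : Fin k → A) (f : A → ℕ) →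
                   sum (map f (tabulate g)) ≡ ∑ k (f ∘ g)
sum-map-tabulate zero    g f = refl
sum-map-tabulate (suc k) g f = cong (f (g zero) +_) (sum-map-tabulate k (g ∘ suc) f)

∑-cong : ∀ k {f g : Fin k → ℕ} → f ≗ g → ∑ k f ≡ ∑ k g
∑-cong zero    f≗g = refl
∑-cong (suc k) f≗g = cong₂ _+_ (f≗g zero) (∑-cong k (f≗g ∘ suc))

∑-+ : ∀ k (f g : Fin k → ℕ) → ∑ k (λ i → f i + g i) ≡ ∑ k f + ∑ k g
∑-+ zero    f g = refl
∑-+ (suc k) f g = trans (cong (f zero + g zero +_) (∑-+ k (f ∘ suc) (g ∘ suc)))
                        (interchange (f zero) (g zero) (∑ k (f ∘ suc)) (∑ k (g ∘ suc)))
  where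
  interchange : ∀ a b c d → a + b + (c + d) ≡ a + c + (b + d)
  interchange = solve-∀

∑-mono : ∀ k {f g : Fin k → ℕ} → f ≤ᵛ g → ∑ k f ≤ ∑ k g
∑-mono zero    f≤g = z≤n
∑-mono (suc k) f≤g = +-mono-≤ (f≤g zero) (∑-mono k (f≤g ∘ suc))

∑-strict : ∀ k {f g : Fin k → ℕ} → f ≤ᵛ g → ∀ u → f u < g u → ∑ k f < ∑ k g
∑-strict (suc k) f≤g zero    fu<gu = +-mono-<-≤ fu<gu (∑-mono k (f≤g ∘ suc))
∑-strict (suc k) f≤g (suc u) fu<gu = +-mono-≤-< (f≤g zero) (∑-strict k (f≤g ∘ suc) u fu<gu)

∑-zero : ∀ k → ∑ k (λ _ → 0) ≡ 0
∑-zero zero    = refl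
∑-zero (suc k) = ∑-zero k

∑≡0⇒zero : ∀ k (f : Fin k → ℕ) → ∑ k f ≡ 0 → ∀ i → f i ≡ 0
∑≡0⇒zero (suc k) f ∑≡0 zero    = m+n≡0⇒m≡0 (f zero) ∑≡0
∑≡0⇒zero (suc k) f ∑≡0 (suc i) = ∑≡0⇒zero k (f ∘ suc) (m+n≡0⇒n≡0 (f zero) ∑≡0) i

∑-δ : ∀ k (v : Fin k) (g : Fin k → ℕ) → ∑ k (λ i → δ v i * g i) ≡ g v
∑-δ (suc k) zero    g = trans (cong (g zero + 0 +_) (∑-zero k))
                              (trans (+-identityʳ _) (+-identityʳ _))
∑-δ (suc k) (suc v) g = ∑-δ k v (g ∘ suc)

∑-+δ : ∀ k (s : Fin k → ℕ) w {t} → t ≐ s +δ w → ∑ k t ≡ suc (∑ k s)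
∑-+δ k s w {t} t≐s+δ = begin
  ∑ k t                        ≡⟨ ∑-cong k t≐s+δ ⟩
  ∑ k (λ u → s u + δ w u)      ≡⟨ ∑-+ k s (δ w) ⟩
  ∑ k s + ∑ k (δ w)            ≡⟨ cong (∑ k s +_) (∑-cong k (λ u → sym (*-identityʳ (δ w u)))) ⟩
  ∑ k s + ∑ k (λ u → δ w u * 1) ≡⟨ cong (∑ k s +_) (∑-δ k w (λ _ → 1)) ⟩
  ∑ k s + 1                    ≡⟨ +-comm (∑ k s) 1 ⟩
  suc (∑ k s)                  ∎
  where open ≡-Reasoning

¬¬-decidable : ∀ {j} (P : Fin j → Set) → ¬ ¬ (∀ u → Dec (P u))
¬¬-decidable {zero}  P never = never (λ ())
¬¬-decidable {suc j} P never =
  ¬¬-excluded-middle λ dec₀ →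
  ¬¬-decidable (P ∘ suc) λ dec₊ →
  never λ { zero → dec₀ ; (suc u) → dec₊ u }

module Firing {k : ℕ} (G : Multigraph k) (acyclic : CFG.Acyclic G) where
  open CFG G

  outdeg≡∑ : ∀ v → outdeg v ≡ ∑ k (G v)
  outdeg≡∑ v = sum-map-tabulate k id (G v)

  no-edge : ∀ {p u} → ¬ Edge p u → G p u ≡ 0
  no-edge {p} {u} ¬p→u with G p u
  ... | zero  = refl
  ... | suc _ = ⊥-elim (¬p→u (s≤s z≤n))

  no-loop : ∀ v → G v v ≡ 0
  no-loop v = no-edge (λ v→v → acyclic v [ v→v ])

  outdeg≡0⇒sink : ∀ v → outdeg v ≡ 0 → Sink v
  outdeg≡0⇒sink v deg≡0 w _ = ∑≡0⇒zero k (G v) (trans (sym (outdeg≡∑ v)) deg≡0) w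

  fire : Config → Fin k → Config
  fire c v w with w ≟ v
  ... | yes _ = c w ∸ outdeg v
  ... | no  _ = c w + G v w

  fire-correct : ∀ c v → Firable c v → Fire v c (fire c v)
  fire-correct c v v-firable = v-firable , λ w → at-v w , elsewhere w
    where
    at-v : ∀ w → w ≡ v → fire c v w + outdeg v ≡ c w + G v w
    at-v w refl with w ≟ w
    ... | no  w≢w = ⊥-elim (w≢w refl)
    ... | yes _   = trans (m∸n+n≡m (proj₂ v-firable))
                          (sym (trans (cong (c w +_) (no-loop w)) (+-identityʳ _)))
    elsewhere : ∀ w → w ≢ v → fire c v w ≡ c w + G v w
    elsewhere w w≢v with w ≟ v
    ... | yes w≡v = ⊥-elim (w≢v w≡v)
    ... | no  _   = refl

  fire-step : ∀ {c} v → Firable c v → c ⟶* fire c v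
  fire-step {c} v v-firable = (v , fire-correct c v v-firable) ◅ ε

  firable-resp : ∀ {c e v} → c ≗ e → Firable c v → Firable e v
  firable-resp {v = v} c≗e (¬sink , enough) = ¬sink , subst (outdeg v ≤_) (c≗e v) enough

  fire-resp : ∀ {v c c′ e e′} → c ≗ e → c′ ≗ e′ → Fire v c c′ → Fire v e e′
  fire-resp {v} c≗e c′≗e′ (v-firable , moves) = firable-resp c≗e v-firable , λ w →
    (λ w≡v → subst₂ (λ a b → a + outdeg v ≡ b + G v w) (c′≗e′ w) (c≗e w) (proj₁ (moves w) w≡v)) ,
    (λ w≢v → subst₂ (λ a b → a ≡ b + G v w) (c′≗e′ w) (c≗e w) (proj₂ (moves w) w≢v))

  shots : ∀ {i j} → i ⟶* j → Fin k → ℕ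
  shots ε                u = 0
  shots ((v , _) ◅ rest) u = δ v u + shots rest u

  shots-◅◅ : ∀ {i j l} (p : i ⟶* j) (q : j ⟶* l) u → shots (p ◅◅ q) u ≡ shots p u + shots q u
  shots-◅◅ ε               q u = refl
  shots-◅◅ ((v , _) ◅ p) q u =
    trans (cong (δ v u +_) (shots-◅◅ p q u)) (sym (+-assoc (δ v u) _ _))

  shots-snoc : ∀ {i j c w} (p : i ⟶* j) (firing : Fire w j c) →
               shots (p ◅◅ ((w , firing) ◅ ε)) ≐ shots p +δ w
  shots-snoc {w = w} p firing u =
    trans (shots-◅◅ p ((w , firing) ◅ ε) u) (cong (shots p u +_) (+-identityʳ (δ w u)))

  first-firing : ∀ {i j} (q : i ⟶* j) → i ≡ j ⊎
    ∃[ w ] Σ Config λ c → Σ (Fire w i c) λ _ → Σ (c ⟶* j) λ rest → ∀ u → shots q u ≡ δ w u + shots rest u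
  first-firing ε                = inj₁ refl
  first-firing ((w , firing) ◅ q) = inj₂ (w , _ , firing , q , λ _ → refl)

  no-shots⇒same : ∀ {i j} (q : i ⟶* j) → (∀ u → shots q u ≡ 0) → i ≡ j
  no-shots⇒same ε               _        = refl
  no-shots⇒same ((v , _) ◅ q) no-shots with trans (cong (_+ shots q v) (sym (δ-same v))) (no-shots v)
  ... | ()

  sinks-never-fire : ∀ {i j} (q : i ⟶* j) u → outdeg u ≡ 0 → shots q u ≡ 0
  sinks-never-fire ε                               u deg≡0 = refl
  sinks-never-fire ((v , (¬sink , _) , _) ◅ q) u deg≡0 with v ≟ u
  ... | yes refl = ⊥-elim (¬sink (outdeg≡0⇒sink v deg≡0))
  ... | no  v≢u  = trans (cong (_+ shots q u) (δ-other v u v≢u)) (sinks-never-fire q u deg≡0)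

  inflow : (Fin k → ℕ) → Fin k → ℕ
  inflow s w = ∑ k (λ u → s u * G u w)

  inflow-+δ : ∀ v (s : Fin k → ℕ) w → inflow (λ u → δ v u + s u) w ≡ G v w + inflow s w
  inflow-+δ v s w = begin
    ∑ k (λ u → (δ v u + s u) * G u w)           ≡⟨ ∑-cong k (λ u → *-distribʳ-+ (G u w) (δ v u) (s u)) ⟩
    ∑ k (λ u → δ v u * G u w + s u * G u w)     ≡⟨ ∑-+ k (λ u → δ v u * G u w) (λ u → s u * G u w) ⟩
    ∑ k (λ u → δ v u * G u w) + inflow s w      ≡⟨ cong (_+ inflow s w) (∑-δ k v (λ u → G u w)) ⟩
    G v w + inflow s w                          ∎
    where open ≡-Reasoning

  inflow-mono : ∀ {s t} → s ≤ᵛ t → inflow s ≤ᵛ inflow t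
  inflow-mono s≤t w = ∑-mono k (λ u → *-monoˡ-≤ (G u w) (s≤t u))

  inflow-cong : ∀ {s t} → s ≗ t → inflow s ≗ inflow t
  inflow-cong s≗t w = ∑-cong k (λ u → cong (_* G u w) (s≗t u))

  conservation : ∀ {i j} (q : i ⟶* j) w →
                 j w + shots q w * outdeg w ≡ i w + inflow (shots q) w
  conservation {i} {j} ε w = cong (j w +_) (sym (∑-zero k))
  conservation {i} {j} ((v , firing) ◅ q) w with w ≟ v
  ... | yes refl = begin
      j w + (δ w w + shots q w) * outdeg w   ≡⟨ cong (λ t → j w + (t + shots q w) * outdeg w) (δ-same w) ⟩
      j w + (1 + shots q w) * outdeg w       ≡⟨ one-more (j w) (shots q w) (outdeg w) ⟩
      (j w + shots q w * outdeg w) + outdeg w ≡⟨ cong (_+ outdeg w) (conservation q w) ⟩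
      (_ + inflow (shots q) w) + outdeg w    ≡⟨ swap _ (inflow (shots q) w) (outdeg w) ⟩
      (_ + outdeg w) + inflow (shots q) w    ≡⟨ cong (_+ inflow (shots q) w) (proj₁ (proj₂ firing w) refl) ⟩
      (i w + G w w) + inflow (shots q) w     ≡⟨ +-assoc (i w) _ _ ⟩
      i w + (G w w + inflow (shots q) w)     ≡⟨ cong (i w +_) (sym (inflow-+δ w (shots q) w)) ⟩
      i w + inflow (shots ((w , firing) ◅ q)) w ∎
    where
    open ≡-Reasoning
    one-more : ∀ a s d → a + (1 + s) * d ≡ (a + s * d) + d
    one-more = solve-∀
    swap : ∀ b f d → (b + f) + d ≡ (b + d) + f
    swap = solve-∀
  ... | no w≢v = begin
      j w + (δ v w + shots q w) * outdeg w   ≡⟨ cong (λ t → j w + (t + shots q w) * outdeg w) (δ-other v w (w≢v ∘ sym)) ⟩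
      j w + shots q w * outdeg w             ≡⟨ conservation q w ⟩
      _ + inflow (shots q) w                 ≡⟨ cong (_+ inflow (shots q) w) (proj₂ (proj₂ firing w) w≢v) ⟩
      (i w + G v w) + inflow (shots q) w     ≡⟨ +-assoc (i w) _ _ ⟩
      i w + (G v w + inflow (shots q) w)     ≡⟨ cong (i w +_) (sym (inflow-+δ v (shots q) w)) ⟩
      i w + inflow (shots ((v , firing) ◅ q)) w ∎
    where open ≡-Reasoning

  -- A set of vertices in which every member has a predecessor in the set is
  -- empty: following predecessors k times revisits a vertex (pigeonhole),
  -- which closes a cycle.
  no-predecessor-closed-set : (P : Fin k → Set) → (∀ u → P u → ∃[ p ] (Edge p u × P p)) →
                              ∀ u → ¬ P u
  no-predecessor-closed-set P back u Pu = acyclic (vertex j) cycle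
    where
    chain : ℕ → Σ (Fin k) P
    chain zero    = u , Pu
    chain (suc t) = let (p , _ , Pp) = back _ (proj₂ (chain t)) in p , Pp
    vertex : ℕ → Fin k
    vertex = proj₁ ∘ chain
    step : ∀ t → Edge (vertex (suc t)) (vertex t)
    step t = proj₁ (proj₂ (back _ (proj₂ (chain t))))
    descent : ∀ t d → TransClosure Edge (vertex (suc d + t)) (vertex t)
    descent t zero    = [ step t ]
    descent t (suc d) = step (suc d + t) ∷ descent t d
    repeat = pigeonhole (n<1+n k) (vertex ∘ Fin.toℕ)
    i j : ℕ
    i = Fin.toℕ (proj₁ repeat)
    j = Fin.toℕ (proj₁ (proj₂ repeat))
    gap = m≤n⇒∃[o]m+o≡n (proj₁ (proj₂ (proj₂ repeat)))
    j≡ : suc (proj₁ gap) + i ≡ j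
    j≡ = trans (cong suc (+-comm (proj₁ gap) i)) (proj₂ gap)
    cycle : TransClosure Edge (vertex j) (vertex j)
    cycle = subst₂ (λ a b → TransClosure Edge (vertex a) b) j≡ (proj₂ (proj₂ (proj₂ repeat)))
                   (descent i (proj₁ gap))

  -- Two firing sequences from the same start to the same configuration have
  -- the same shot vector: a vertex where they differ must receive a
  -- different inflow, so some predecessor also differs.
  shots-unique : ∀ {o c c′} (p : o ⟶* c) (q : o ⟶* c′) → c ≗ c′ → shots p ≗ shots q
  shots-unique {o} {c} {c′} p q c≗c′ u with shots p u ≟ℕ shots q u
  ... | yes same = same
  ... | no  diff = ⊥-elim (no-predecessor-closed-set (λ u → shots p u ≢ shots q u) back u diff)
    where
    back : ∀ u → shots p u ≢ shots q u → ∃[ p₀ ] (Edge p₀ u × (shots p p₀ ≢ shots q p₀))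
    back u diff with all? (λ p₀ → shots p p₀ * G p₀ u ≟ℕ shots q p₀ * G p₀ u)
    ... | no some = let (p₀ , diff₀) = ¬∀⟶∃¬ k _ (λ p₀ → shots p p₀ * G p₀ u ≟ℕ shots q p₀ * G p₀ u) some
                    in p₀ , edge p₀ diff₀ , diff₀ ∘ cong (_* G p₀ u)
      where
      edge : ∀ p₀ → shots p p₀ * G p₀ u ≢ shots q p₀ * G p₀ u → Edge p₀ u
      edge p₀ diff₀ with G p₀ u
      ... | zero  = ⊥-elim (diff₀ (trans (*-zeroʳ (shots p p₀)) (sym (*-zeroʳ (shots q p₀)))))
      ... | suc _ = s≤s z≤n
    ... | yes all = ⊥-elim (diff same-shots)
      where
      sent : c u + shots p u * outdeg u ≡ c u + shots q u * outdeg u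
      sent = trans (conservation p u) (trans (cong (o u +_) (∑-cong k all))
               (trans (sym (conservation q u)) (cong (_+ _) (sym (c≗c′ u)))))
      same-shots : shots p u ≡ shots q u
      same-shots with outdeg u in deg
      ... | zero  = trans (sinks-never-fire p u deg) (sym (sinks-never-fire q u deg))
      ... | suc d = *-cancelʳ-≡ _ _ (suc d)
                      (subst (λ t → shots p u * t ≡ shots q u * t) deg (+-cancelˡ-≡ (c u) _ _ sent))

  shots-determine : ∀ {o c c′} (p : o ⟶* c) (q : o ⟶* c′) → shots p ≗ shots q → c ≗ c′
  shots-determine {o} {c} {c′} p q same w = +-cancelʳ-≡ _ _ _ (begin
    c w + shots p w * outdeg w  ≡⟨ conservation p w ⟩
    o w + inflow (shots p) w    ≡⟨ cong (o w +_) (inflow-cong same w) ⟩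
    o w + inflow (shots q) w    ≡⟨ sym (conservation q w) ⟩
    c′ w + shots q w * outdeg w ≡⟨ cong (λ t → c′ w + t * outdeg w) (sym (same w)) ⟩
    c′ w + shots p w * outdeg w ∎)
    where open ≡-Reasoning

  -- If the sequence q fires some vertex more often than p, then some vertex
  -- that q fires more often is already firable at the end of p.  We follow q
  -- from its start, keeping the prefix r dominated by p; the first firing of
  -- q that exceeds p happens at a vertex which p has fed at least as much.
  deficit-firable-after : ∀ {o i c d} (p : o ⟶* c) (r : o ⟶* i) (q : i ⟶* d) →
    shots r ≤ᵛ shots p → ∃[ u ] (shots p u < shots r u + shots q u) →
    ∃[ w ] (Firable c w × shots p w < shots r w + shots q w)
  deficit-firable-after p r ε r≤p (u , excess) =
    ⊥-elim (<⇒≱ excess (subst (_≤ shots p u) (sym (+-identityʳ _)) (r≤p u)))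
  deficit-firable-after {o} {i} {c} p r ((w , firing) ◅ q) r≤p excess with shots r w <? shots p w
  ... | no r≮p = w , (proj₁ (proj₁ firing) , ≤-trans (proj₂ (proj₁ firing)) enough) , exceeds
    where
    r≡p : shots r w ≡ shots p w
    r≡p = ≤-antisym (r≤p w) (≮⇒≥ r≮p)
    enough : i w ≤ c w
    enough = +-cancelʳ-≤ (shots p w * outdeg w) _ _ (begin
        i w + shots p w * outdeg w ≡⟨ cong (λ t → i w + t * outdeg w) (sym r≡p) ⟩
        i w + shots r w * outdeg w ≡⟨ conservation r w ⟩
        o w + inflow (shots r) w   ≤⟨ +-monoʳ-≤ (o w) (inflow-mono r≤p w) ⟩
        o w + inflow (shots p) w   ≡⟨ sym (conservation p w) ⟩
        c w + shots p w * outdeg w ∎)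
      where open ≤-Reasoning
    exceeds : shots p w < shots r w + (δ w w + shots q w)
    exceeds = subst₂ (λ a t → suc a ≤ shots r w + (t + shots q w)) r≡p (sym (δ-same w))
                (subst (suc (shots r w) ≤_) (sym (+-suc (shots r w) (shots q w))) (s≤s (m≤m+n _ _)))
  ... | yes r<p = let (v , v-firable , lt) = deficit-firable-after p r′ q r′≤p excess′
                  in v , v-firable , subst (shots p v <_) (regroup v) lt
    where
    first = (w , firing) ◅ ε
    r′ = r ◅◅ first
    regroup : ∀ u → shots r′ u + shots q u ≡ shots r u + (δ w u + shots q u)
    regroup u = trans (cong (_+ shots q u) (shots-◅◅ r first u)) (assoc (shots r u) (δ w u) (shots q u))
      where
      assoc : ∀ a b c → a + (b + 0) + c ≡ a + (b + c)
      assoc = solve-∀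
    r′≤p : shots r′ ≤ᵛ shots p
    r′≤p u with w ≟ u
    ... | yes refl = subst (_≤ shots p u) (sym (trans (shots-◅◅ r first u)
                       (trans (cong (shots r u +_) (+-identityʳ _)) (+δ-same (shots r) u)))) r<p
    ... | no  w≢u  = subst (_≤ shots p u) (sym (trans (shots-◅◅ r first u)
                       (trans (cong (shots r u +_) (+-identityʳ _)) (+δ-other (shots r) w≢u)))) (r≤p u)
    excess′ : ∃[ u ] (shots p u < shots r′ u + shots q u)
    excess′ = let (u , lt) = excess in u , subst (shots p u <_) (sym (regroup u)) lt

  deficit-firable : ∀ {o c d} (p : o ⟶* c) (q : o ⟶* d) → ∃[ u ] (shots p u < shots q u) →
                    ∃[ w ] (Firable c w × shots p w < shots q w)
  deficit-firable p q = deficit-firable-after p ε q (λ _ → z≤n)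

  -- A reachable configuration d whose shot vector dominates that of c is
  -- reachable from c: fire a vertex with a deficit, repeatedly.  The
  -- recursion is on a bound for the total deficit.
  reach-by-shots : ∀ {o c d} (bound : ℕ) (p : o ⟶* c) (q : o ⟶* d) →
    shots p ≤ᵛ shots q → ∃[ u ] (shots p u < shots q u) →
    ∑ k (shots q) ≤ bound + ∑ k (shots p) → c ⟶* d
  reach-by-shots zero p q p≤q (u , p<q) total≤ = ⊥-elim (<⇒≱ (∑-strict k p≤q u p<q) total≤)
  reach-by-shots {o} {c} {d} (suc bound) p q p≤q deficit total≤ with deficit-firable p q deficit
  ... | (w , w-firable , p<q) = continue (pointwise? (shots p′) (shots q))
    where
    p′ = p ◅◅ fire-step w w-firable
    p′≐ : shots p′ ≐ shots p +δ w
    p′≐ = shots-snoc p (fire-correct c w w-firable)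
    p′≤q : shots p′ ≤ᵛ shots q
    p′≤q u with w ≟ u
    ... | yes refl = subst (_≤ shots q u) (sym (trans (p′≐ u) (+δ-same (shots p) u))) p<q
    ... | no  w≢u  = subst (_≤ shots q u) (sym (trans (p′≐ u) (+δ-other (shots p) w≢u))) (p≤q u)
    continue : Dec (shots p′ ≗ shots q) → c ⟶* d
    continue (yes done) = (w , fire-resp (λ _ → refl) (shots-determine p′ q done)
                               (fire-correct c w w-firable)) ◅ ε
    continue (no more)  = fire-step w w-firable ◅◅
      reach-by-shots bound p′ q p′≤q (strictly-somewhere p′≤q more)
        (subst (∑ k (shots q) ≤_) (trans (sym (+-suc bound _)) (cong (bound +_) (sym (∑-+δ k (shots p) w p′≐)))) total≤)

  -- Restriction to an ancestor-closed set B: from any configuration that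
  -- agrees with i on B we can replay exactly the firings of q at vertices of
  -- B; since chips only flow forward, B sees the same chips as under q.
  restrict : (B : Fin k → Set) → (∀ u → Dec (B u)) → (∀ p u → Edge p u → B u → B p) →
    ∀ {i j i′} (q : i ⟶* j) → (∀ u → B u → i′ u ≡ i u) →
    Σ Config λ j′ → Σ (i′ ⟶* j′) λ q′ → (∀ u → B u → j′ u ≡ j u) ×
      (∀ u → B u → shots q′ u ≡ shots q u) × (∀ u → ¬ B u → shots q′ u ≡ 0)
  restrict B B? closed ε agree = _ , ε , agree , (λ _ _ → refl) , (λ _ _ → refl)
  restrict B B? closed {i} {j} {i′} (_◅_ {j = b} (v , firing) q) agree with B? v
  ... | yes Bv = let (j′ , q′ , ends , inB , outB) = restrict B B? closed q agree′
                 in j′ , (v , fire-correct i′ v v-firable) ◅ q′ , ends ,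
                    (λ u Bu → cong (δ v u +_) (inB u Bu)) ,
                    (λ u ¬Bu → trans (cong₂ _+_ (δ-other v u (λ v≡u → ¬Bu (subst B v≡u Bv))) (outB u ¬Bu)) refl)
    where
    v-firable : Firable i′ v
    v-firable = proj₁ (proj₁ firing) , subst (outdeg v ≤_) (sym (agree v Bv)) (proj₂ (proj₁ firing))
    agree′ : ∀ u → B u → fire i′ v u ≡ b u
    agree′ u Bu with u ≟ v
    ... | yes refl = trans (cong (_∸ outdeg u) (agree u Bu))
           (trans (cong (_∸ outdeg u) (sym (trans (proj₁ (proj₂ firing u) refl)
                                              (trans (cong (i u +_) (no-loop u)) (+-identityʳ _)))))
              (m+n∸n≡m (b u) (outdeg u)))
    ... | no u≢v = trans (cong (_+ G v u) (agree u Bu)) (sym (proj₂ (proj₂ firing u) u≢v))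
  ... | no ¬Bv = let (j′ , q′ , ends , inB , outB) = restrict B B? closed q agree′
                 in j′ , q′ , ends ,
                    (λ u Bu → trans (inB u Bu) (sym (cong (_+ shots q u) (δ-other v u (λ v≡u → ¬Bv (subst B (sym v≡u) Bu)))))) ,
                    outB
    where
    agree′ : ∀ u → B u → i′ u ≡ b u
    agree′ u Bu = trans (agree u Bu) (trans (sym (+-identityʳ (i u)))
                    (trans (cong (i u +_) (sym (no-edge (λ v→u → ¬Bv (closed v u v→u Bu)))))
                           (sym (proj₂ (proj₂ firing u) (λ u≡v → ¬Bv (subst B u≡v Bu))))))

  _⋖_ : Fin k × ℕ → Fin k × ℕ → Set
  (v , s) ⋖ (v′ , s′) = TransClosure Edge v v′ ⊎ (v ≡ v′ × s < s′)

  ⋖-trans : ∀ {x y z} → x ⋖ y → y ⋖ z → x ⋖ z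
  ⋖-trans (inj₁ p)          (inj₁ q)          = inj₁ (p ++⁺ q)
  ⋖-trans (inj₁ p)          (inj₂ (refl , _)) = inj₁ p
  ⋖-trans (inj₂ (refl , _)) (inj₁ q)          = inj₁ q
  ⋖-trans (inj₂ (refl , l)) (inj₂ (refl , m)) = inj₂ (refl , <-trans l m)

  ⋖-irrefl : ∀ {x} → ¬ (x ⋖ x)
  ⋖-irrefl {v , _} (inj₁ cycle)     = acyclic v cycle
  ⋖-irrefl         (inj₂ (_ , s<s)) = <-irrefl refl s<s

-- A poset with binary meets generated by a Chip Firing Game on an acyclic
-- multigraph, described through shot vectors.

module Generated {n : ℕ} (_≼_ : Rel (Fin n) 0ℓ) (_∧_ : Op₂ (Fin n))
    (isPartialOrder : IsPartialOrder _≡_ _≼_) (infimum : Infimum _≼_ _∧_)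
    {k : ℕ} (G : Multigraph k) (acyclic : CFG.Acyclic G) (o : Fin k → ℕ)
    (f : Fin n → Fin k → ℕ) (reach : ∀ x → CFG._⟶*_ G o (f x))
    (surj : ∀ c → CFG._⟶*_ G o c → ∃[ x ] (f x ≗ c))
    (ord : ∀ x y → (x ≼ y) ⇔ CFG._⟶*_ G (f x) (f y)) where
  open CFG G
  open Firing G acyclic
  open OrderNotions _≼_
  open IsPartialOrder isPartialOrder using (antisym) renaming (refl to ≼-refl; trans to ≼-trans)

  ∧-lower₁ : ∀ x y → (x ∧ y) ≼ x
  ∧-lower₁ x y = proj₁ (infimum x y)

  ∧-lower₂ : ∀ x y → (x ∧ y) ≼ y
  ∧-lower₂ x y = proj₁ (proj₂ (infimum x y))

  ∧-greatest : ∀ {x y z} → z ≼ x → z ≼ y → z ≼ (x ∧ y)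
  ∧-greatest {x} {y} {z} = proj₂ (proj₂ (infimum x y)) z

  path : ∀ {x y} → x ≼ y → f x ⟶* f y
  path {x} {y} = Equivalence.to (ord x y)

  order : ∀ {x y} → f x ⟶* f y → x ≼ y
  order {x} {y} = Equivalence.from (ord x y)

  -- The shot vector of an element; by shots-unique it does not depend on
  -- the chosen firing sequence.
  σ : Fin n → Fin k → ℕ
  σ x = shots (reach x)

  σ-along : ∀ {x y} (x≼y : x ≼ y) u → σ y u ≡ σ x u + shots (path x≼y) u
  σ-along {x} {y} x≼y u = trans (sym (shots-unique (reach x ◅◅ path x≼y) (reach y) (λ _ → refl) u))
                                (shots-◅◅ (reach x) (path x≼y) u)

  σ-mono : ∀ {x y} → x ≼ y → σ x ≤ᵛ σ y
  σ-mono x≼y u = subst (σ _ u ≤_) (sym (σ-along x≼y u)) (m≤m+n _ _)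

  σ-reflect : ∀ {x y} → σ x ≤ᵛ σ y → ∃[ u ] (σ x u < σ y u) → x ≼ y
  σ-reflect {x} {y} x≤y x<y = order (reach-by-shots (∑ k (σ y)) (reach x) (reach y) x≤y x<y (m≤m+n _ _))

  σ-injective : ∀ {x y} → x ≼ y → σ x ≗ σ y → x ≡ y
  σ-injective {x} {y} x≼y x≗y = antisym x≼y (order (subst (f y ⟶*_) (sym fx≡fy) ε))
    where
    fx≡fy : f x ≡ f y
    fx≡fy = no-shots⇒same (path x≼y) (λ u → +-cancelˡ-≡ (σ x u) _ _
              (trans (sym (σ-along x≼y u)) (trans (sym (x≗y u)) (sym (+-identityʳ _)))))

  single-shot⇒cover : ∀ {x y} w → σ y ≐ σ x +δ w → x ≺ y
  single-shot⇒cover {x} {y} w y≐ = x≼y , x≢y , between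
    where
    x≼y : x ≼ y
    x≼y = σ-reflect (≐⇒≤ᵛ (σ x) w y≐) (w , one-more-at (σ x) w y≐)
    x≢y : x ≢ y
    x≢y refl = <-irrefl refl (one-more-at (σ x) w y≐)
    between : ∀ z → x ≼ z → z ≼ y → z ≡ x ⊎ z ≡ y
    between z x≼z z≼y with squeeze w (σ-mono x≼z) (λ u → subst (σ z u ≤_) (y≐ u) (σ-mono z≼y u))
    ... | inj₁ z≗x = inj₁ (sym (σ-injective x≼z (λ u → sym (z≗x u))))
    ... | inj₂ z≐  = inj₂ (σ-injective z≼y (λ u → trans (z≐ u) (sym (y≐ u))))

  firable⇒cover : ∀ {x w} → Firable (f x) w → ∃[ y ] (x ≺ y × σ y ≐ σ x +δ w)
  firable⇒cover {x} {w} w-firable with surj _ (reach x ◅◅ fire-step w w-firable)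
  ... | (y , fy≗) = y , single-shot⇒cover w y≐ , y≐
    where
    y≐ : σ y ≐ σ x +δ w
    y≐ u = trans (shots-unique (reach y) (reach x ◅◅ fire-step w w-firable) fy≗ u)
                 (shots-snoc (reach x) (fire-correct (f x) w w-firable) u)

  -- Conversely a cover x ≺ y is reached by firing once: after the first
  -- firing of a path from x to y we are at an element strictly between x
  -- and y or at y itself.
  cover⇒single-shot : ∀ {x y} → x ≺ y → ∃[ w ] (Firable (f x) w × σ y ≐ σ x +δ w)
  cover⇒single-shot {x} {y} (x≼y , x≢y , between) with first-firing (path x≼y)
  ... | inj₁ fx≡fy = ⊥-elim (x≢y (antisym x≼y (order (subst (f y ⟶*_) (sym fx≡fy) ε))))
  ... | inj₂ (w , c , firing , rest , shots≡) with surj c (reach x ◅◅ ((w , firing) ◅ ε))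
  ...   | (z , fz≗c) = w , proj₁ firing , y≐
    where
    z≐ : σ z ≐ σ x +δ w
    z≐ u = trans (shots-unique (reach z) (reach x ◅◅ ((w , firing) ◅ ε)) fz≗c u)
                 (shots-snoc (reach x) firing u)
    z≤y : σ z ≤ᵛ σ y
    z≤y u = subst₂ _≤_ (sym (z≐ u)) (sym (σ-along x≼y u))
              (+-monoʳ-≤ (σ x u) (subst (δ w u ≤_) (sym (shots≡ u)) (m≤m+n _ _)))
    y≐ : σ y ≐ σ x +δ w
    y≐ with pointwise? (σ z) (σ y)
    ... | yes z≗y = λ u → trans (sym (z≗y u)) (z≐ u)
    ... | no  z≉y with between z (proj₁ (single-shot⇒cover w z≐)) (σ-reflect z≤y (strictly-somewhere z≤y z≉y))
    ...   | inj₁ refl = ⊥-elim (<-irrefl refl (one-more-at (σ z) w z≐))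
    ...   | inj₂ refl = ⊥-elim (z≉y (λ _ → refl))

  firing-vertex : ∀ {m} → InM m → ∃[ v ] Firable (f m) v
  firing-vertex (_ , m≺y , _) = let (v , v-firable , _) = cover⇒single-shot m≺y in v , v-firable

  firing-vertex-unique : ∀ {m v v′} → InM m → Firable (f m) v → Firable (f m) v′ → v ≡ v′
  firing-vertex-unique {m} {v} {v′} (_ , _ , unique) v-firable v′-firable with firable⇒cover v-firable | firable⇒cover v′-firable
  ... | (y , m≺y , y≐) | (y′ , m≺y′ , y′≐) =
    +δ-injective (σ m) v v′ y≐ (subst (λ t → σ t ≐ σ m +δ v′) (trans (unique y′ m≺y′) (sym (unique y m≺y))) y′≐)

  twins-share-firings : ∀ {x m w} → σ x ≗ σ m → Firable (f x) w → Firable (f m) w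
  twins-share-firings {x} {m} twin = firable-resp (shots-determine (reach x) (reach m) twin)

  -- An element that has fired the firing vertex of m at most as often as m
  -- lies below m, unless it is a twin of m: otherwise a vertex it fired more
  -- often than m would be firable at m.
  below-meet-irreducible : ∀ {m v x} → InM m → Firable (f m) v → σ x v ≤ σ m v → ¬ (σ x ≗ σ m) → x ≼ m
  below-meet-irreducible {m} {v} {x} m∈M v-firable xᵥ≤mᵥ x≉m with all? (λ u → σ x u ≤? σ m u)
  ... | yes x≤m = σ-reflect x≤m (strictly-somewhere x≤m x≉m)
  ... | no  x≰m with ¬∀⟶∃¬ k _ (λ u → σ x u ≤? σ m u) x≰m
  ...   | (u , xᵤ≰mᵤ) with deficit-firable (reach m) (reach x) (u , ≰⇒> xᵤ≰mᵤ)
  ...     | (w , w-firable , mw<xw) with firing-vertex-unique m∈M w-firable v-firable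
  ...       | refl = ⊥-elim (<⇒≱ mw<xw xᵥ≤mᵥ)

  not-below : ∀ {m v y} → InM m → Firable (f m) v → ¬ y ≼ m → σ m v < σ y v ⊎ σ y ≗ σ m
  not-below {m} {v} {y} m∈M v-firable y⋠m with σ y v ≤? σ m v
  ... | no  yᵥ≰mᵥ = inj₁ (≰⇒> yᵥ≰mᵥ)
  ... | yes yᵥ≤mᵥ with pointwise? (σ y) (σ m)
  ...   | yes y≗m = inj₂ y≗m
  ...   | no  y≉m = ⊥-elim (y⋠m (below-meet-irreducible m∈M v-firable yᵥ≤mᵥ y≉m))

  -- Distinct twins x, m: the meet x ∧ m is covered by m, since anything
  -- strictly between lies below x as well.
  twin-meet-cover : ∀ {x m} → x ≢ m → σ x ≗ σ m → (x ∧ m) ≺ m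
  twin-meet-cover {x} {m} x≢m twin = ∧-lower₂ x m , b≢m , between
    where
    b≢m : (x ∧ m) ≢ m
    b≢m b≡m = x≢m (sym (σ-injective (subst (_≼ x) b≡m (∧-lower₁ x m)) (λ u → sym (twin u))))
    between : ∀ z → (x ∧ m) ≼ z → z ≼ m → z ≡ (x ∧ m) ⊎ z ≡ m
    between z b≼z z≼m with pointwise? (σ z) (σ m)
    ... | yes z≗m = inj₂ (σ-injective z≼m z≗m)
    ... | no  z≉m = inj₁ (antisym (∧-greatest z≼x z≼m) b≼z)
      where
      z≤x : σ z ≤ᵛ σ x
      z≤x u = subst (σ z u ≤_) (sym (twin u)) (σ-mono z≼m u)
      z≼x : z ≼ x
      z≼x = let (u , zᵤ<mᵤ) = strictly-somewhere (σ-mono z≼m) z≉m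
            in σ-reflect z≤x (u , subst (σ z u <_) (sym (twin u)) zᵤ<mᵤ)

  InS-intro : ∀ {m z z′} → InM m → z ≺ z′ → z ≼ m → ¬ z′ ≼ m → InS m z
  InS-intro m∈M z≺z′ z≼m z′⋠m = _ , z≺z′ , (m∈M , z≼m) , (λ z′∈Mₘ → z′⋠m (proj₂ z′∈Mₘ))

  module KeyLemma {m₁ m₂ a y : Fin n} {v₁ v₂ : Fin k}
      (m₁∈M : InM m₁) (m₂∈M : InM m₂)
      (a≺y : a ≺ y) (a≼m₂ : a ≼ m₂) (y⋠m₂ : ¬ y ≼ m₂)
      (a-minimal : ∀ x → InS m₂ x → x ≼ a → x ≡ a) (a⋠m₁ : ¬ a ≼ m₁)
      (v₁-firable : Firable (f m₁) v₁) (v₂-firable : Firable (f m₂) v₂) where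

    w : Fin k
    w = proj₁ (cover⇒single-shot a≺y)

    w-firable : Firable (f a) w
    w-firable = proj₁ (proj₂ (cover⇒single-shot a≺y))

    y≐ : σ y ≐ σ a +δ w
    y≐ = proj₂ (proj₂ (cover⇒single-shot a≺y))

    -- Since y ⋠ m₂: either y has fired v₂ more often than m₂, and then the
    -- firing from a to y is at v₂ with a, m₂ agreeing at v₂; or σ y = σ m₂.
    y-versus-m₂ : (w ≡ v₂ × σ a v₂ ≡ σ m₂ v₂) ⊎ σ y ≗ σ m₂
    y-versus-m₂ with not-below m₂∈M v₂-firable y⋠m₂
    ... | inj₁ m₂<y = inj₁ (squeezed-at {s = σ a} {t = σ m₂} (σ-mono a≼m₂ v₂) (subst (σ m₂ v₂ <_) (y≐ v₂) m₂<y))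
    ... | inj₂ y≗m₂ = inj₂ y≗m₂

    -- m₂ ∧ y lies between a and y, and is not y since y ⋠ m₂.
    meet-is-a : (m₂ ∧ y) ≡ a
    meet-is-a with proj₂ (proj₂ a≺y) (m₂ ∧ y) (∧-greatest a≼m₂ (proj₁ a≺y)) (∧-lower₂ m₂ y)
    ... | inj₁ b≡a = b≡a
    ... | inj₂ b≡y = ⊥-elim (y⋠m₂ (subst (_≼ m₂) b≡y (∧-lower₁ m₂ y)))

    -- A twin would fire only v₁, so w = v₁ and y is
    -- the unique upper cover of m₁.  If σ y = σ m₂ this makes y = m₂.
    -- Otherwise w = v₂, and then a = m₂ (a ∧ m₁ would be an element of
    -- S m₂ strictly below a) or a lags behind m₂ at a vertex firable at a,
    -- i.e. at v₁ = v₂, where they agree.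
    twin-fires-only-v₁ : σ a ≗ σ m₁ → ∀ {u} → Firable (f a) u → u ≡ v₁
    twin-fires-only-v₁ twin u-firable = firing-vertex-unique m₁∈M (twins-share-firings twin u-firable) v₁-firable

    not-twin : ¬ (σ a ≗ σ m₁)
    not-twin twin with y-versus-m₂
    ... | inj₂ y≗m₂ = y⋠m₂ (subst (y ≼_) y≡m₂ ≼-refl)
      where
      y≐m₁ : σ y ≐ σ m₁ +δ v₁
      y≐m₁ u = trans (y≐ u) (cong₂ _+_ (twin u) (cong (λ t → δ t u) (twin-fires-only-v₁ twin w-firable)))
      y≡m₂ : y ≡ m₂
      y≡m₂ = let (_ , _ , unique) = m₁∈M in
             trans (unique y (single-shot⇒cover v₁ y≐m₁))
                   (sym (unique m₂ (single-shot⇒cover v₁ (λ u → trans (sym (y≗m₂ u)) (y≐m₁ u)))))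
    ... | inj₁ (w≡v₂ , aᵥ₂≡m₂ᵥ₂) with pointwise? (σ a) (σ m₂)
    ...   | yes a≗m₂ = a⋠m₁ (subst (_≼ m₁) b≡a (∧-lower₂ a m₁))
      where
      a≢m₁ : a ≢ m₁
      a≢m₁ a≡m₁ = a⋠m₁ (subst (a ≼_) a≡m₁ ≼-refl)
      a≡m₂ : a ≡ m₂
      a≡m₂ = σ-injective a≼m₂ a≗m₂
      m₁⋠m₂ : ¬ m₁ ≼ m₂
      m₁⋠m₂ m₁≼m₂ = a≢m₁ (sym (σ-injective (subst (m₁ ≼_) (sym a≡m₂) m₁≼m₂) (λ u → sym (twin u))))
      b≡a : (a ∧ m₁) ≡ a
      b≡a = a-minimal (a ∧ m₁)
              (InS-intro m₂∈M (twin-meet-cover a≢m₁ twin) (≼-trans (∧-lower₁ a m₁) a≼m₂) m₁⋠m₂)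
              (∧-lower₁ a m₁)
    ...   | no a≉m₂ = let (u , u-firable , aᵤ<m₂ᵤ) = deficit-firable (reach a) (reach m₂)
                                                         (strictly-somewhere (σ-mono a≼m₂) a≉m₂)
                          u≡v₂ = trans (twin-fires-only-v₁ twin u-firable) (trans (sym (twin-fires-only-v₁ twin w-firable)) w≡v₂)
                      in <-irrefl (subst (λ t → σ a t ≡ σ m₂ t) (sym u≡v₂) aᵥ₂≡m₂ᵥ₂) aᵤ<m₂ᵤ

    v₁-increase : σ m₁ v₁ < σ a v₁
    v₁-increase with not-below m₁∈M v₁-firable a⋠m₁
    ... | inj₁ m₁<a = m₁<a
    ... | inj₂ twin = ⊥-elim (not-twin twin)

    minimal-fired-v₁ : ∀ z → InS m₂ z → z ≼ a → σ z v₁ ≢ 0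
    minimal-fired-v₁ z z∈S z≼a zᵥ₁≡0 =
      <-irrefl (sym (subst (λ t → σ t v₁ ≡ 0) (a-minimal z z∈S z≼a) zᵥ₁≡0)) (≤-<-trans z≤n v₁-increase)

    Feeds : Fin k → Set
    Feeds u = u ≡ v₂ ⊎ TransClosure Edge u v₂

    feeds-closed : ∀ p u → Edge p u → Feeds u → Feeds p
    feeds-closed p u p→u (inj₁ refl)  = inj₂ [ p→u ]
    feeds-closed p u p→u (inj₂ u→⁺v₂) = inj₂ (p→u ∷ u→⁺v₂)

    -- If v₁ does not feed v₂, replaying only the firings at vertices that
    -- feed v₂ from an element r ≼ m₂ that agrees with m₂ at v₂, where v₂ is
    -- firable, gives an element z ≼ r of S m₂ which never fired v₁.
    restricted-below : (∀ u → Dec (Feeds u)) → ¬ Feeds v₁ →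
      ∀ r → r ≼ m₂ → Firable (f r) v₂ → σ r v₂ ≡ σ m₂ v₂ → 0 < σ r v₁ →
      ∃[ z ] (InS m₂ z × z ≼ r × σ z ≤ᵛ σ r × σ z v₁ ≡ 0)
    restricted-below Feeds? v₁-isolated r r≼m₂ v₂-firable-at-r rᵥ₂≡m₂ᵥ₂ r-fired-v₁
      with restrict Feeds Feeds? feeds-closed (reach r) (λ _ _ → refl)
    ... | (c , q , ends , inB , outB) with surj c q
    ...   | (z , fz≗c) = z , InS-intro m₂∈M z≺z′ (≼-trans z≼r r≼m₂) z′⋠m₂ , z≼r , z≤r , zᵥ₁≡0
      where
      σz≗ : σ z ≗ shots q
      σz≗ = shots-unique (reach z) q fz≗c
      z≤r : σ z ≤ᵛ σ r
      z≤r u with Feeds? u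
      ... | yes Bu  = ≤-reflexive (trans (σz≗ u) (inB u Bu))
      ... | no  ¬Bu = subst (_≤ σ r u) (sym (trans (σz≗ u) (outB u ¬Bu))) z≤n
      zᵥ₁≡0 : σ z v₁ ≡ 0
      zᵥ₁≡0 = trans (σz≗ v₁) (outB v₁ v₁-isolated)
      z≼r : z ≼ r
      z≼r = σ-reflect z≤r (v₁ , subst (_< σ r v₁) (sym zᵥ₁≡0) r-fired-v₁)
      zᵥ₂≡m₂ᵥ₂ : σ z v₂ ≡ σ m₂ v₂
      zᵥ₂≡m₂ᵥ₂ = trans (trans (σz≗ v₂) (inB v₂ (inj₁ refl))) rᵥ₂≡m₂ᵥ₂
      v₂-firable-at-z : Firable (f z) v₂
      v₂-firable-at-z = proj₁ v₂-firable-at-r ,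
        subst (outdeg v₂ ≤_) (sym (trans (fz≗c v₂) (ends v₂ (inj₁ refl)))) (proj₂ v₂-firable-at-r)
      cover = firable⇒cover v₂-firable-at-z
      z′ = proj₁ cover
      z≺z′ : z ≺ z′
      z≺z′ = proj₁ (proj₂ cover)
      z′⋠m₂ : ¬ z′ ≼ m₂
      z′⋠m₂ z′≼m₂ = <⇒≱ (subst (_< σ z′ v₂) zᵥ₂≡m₂ᵥ₂ (one-more-at (σ z) v₂ (proj₂ (proj₂ cover))))
                        (σ-mono z′≼m₂ v₂)

    -- Hence v₁ feeds v₂: restrict from a (if y fired v₂ once more than m₂)
    -- or from m₂ (if σ y = σ m₂, the result lies below m₂ ∧ y = a).
    v₁-feeds-v₂ : (∀ u → Dec (Feeds u)) → ¬ ¬ Feeds v₁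
    v₁-feeds-v₂ Feeds? v₁-isolated with y-versus-m₂
    ... | inj₁ (w≡v₂ , aᵥ₂≡m₂ᵥ₂) =
      let (z , z∈S , z≼a , _ , zᵥ₁≡0) = restricted-below Feeds? v₁-isolated a a≼m₂
                                           (subst (Firable (f a)) w≡v₂ w-firable) aᵥ₂≡m₂ᵥ₂
                                           (≤-<-trans z≤n v₁-increase)
      in minimal-fired-v₁ z z∈S z≼a zᵥ₁≡0
    ... | inj₂ y≗m₂ =
      let m₂-fired-v₁ = ≤-<-trans z≤n (<-≤-trans v₁-increase (σ-mono a≼m₂ v₁))
          (z , z∈S , z≼m₂ , z≤m₂ , zᵥ₁≡0) = restricted-below Feeds? v₁-isolated m₂ ≼-refl v₂-firable refl m₂-fired-v₁
          z≼y = σ-reflect (λ u → subst (σ z u ≤_) (sym (y≗m₂ u)) (z≤m₂ u))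
                          (v₁ , subst₂ _<_ (sym zᵥ₁≡0) (sym (y≗m₂ v₁)) m₂-fired-v₁)
      in minimal-fired-v₁ z z∈S (subst (z ≼_) meet-is-a (∧-greatest z≼m₂ z≼y)) zᵥ₁≡0

    key : ¬ ¬ ((v₁ , σ m₁ v₁) ⋖ (v₂ , σ m₂ v₂))
    key not-⋖ with v₁ ≟ v₂
    ... | yes refl = not-⋖ (inj₂ (refl , <-≤-trans v₁-increase (σ-mono a≼m₂ v₁)))
    ... | no  v₁≢v₂ = ¬¬-decidable Feeds decided
      where
      decided : (∀ u → Dec (Feeds u)) → ⊥
      decided Feeds? with Feeds? v₁
      ... | yes (inj₁ v₁≡v₂)   = v₁≢v₂ v₁≡v₂
      ... | yes (inj₂ v₁→⁺v₂) = not-⋖ (inj₁ v₁→⁺v₂)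
      ... | no  v₁-isolated     = v₁-feeds-v₂ Feeds? v₁-isolated

  edge-⋖ : ∀ {m₁ m₂ v₁ v₂} → GEdge m₁ m₂ → Firable (f m₁) v₁ → Firable (f m₂) v₂ →
           ¬ ¬ ((v₁ , σ m₁ v₁) ⋖ (v₂ , σ m₂ v₂))
  edge-⋖ (m₁∈M , m₂∈M , a , ((y , a≺y , (_ , a≼m₂) , y∉Mₘ₂) , a-minimal) , a∉Mₘ₁) =
    KeyLemma.key m₁∈M m₂∈M a≺y a≼m₂ (λ y≼m₂ → y∉Mₘ₂ (m₂∈M , y≼m₂)) a-minimal
                 (λ a≼m₁ → a∉Mₘ₁ (m₁∈M , a≼m₁))

  path-⋖ : ∀ {m₁ m₂ v₁ v₂} → TransClosure GEdge m₁ m₂ → Firable (f m₁) v₁ → Firable (f m₂) v₂ →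
           ¬ ¬ ((v₁ , σ m₁ v₁) ⋖ (v₂ , σ m₂ v₂))
  path-⋖ [ e ]        = edge-⋖ e
  path-⋖ (e ∷ rest) v₁-firable v₂-firable not-⋖ =
    let (v , v-firable) = firing-vertex (proj₁ (proj₂ e)) in
    edge-⋖ e v₁-firable v-firable λ first → path-⋖ rest v-firable v₂-firable λ later →
    not-⋖ (⋖-trans first later)

  source-in-M : ∀ {m₁ m₂} → TransClosure GEdge m₁ m₂ → InM m₁
  source-in-M [ e ]     = proj₁ e
  source-in-M (e ∷ _) = proj₁ e

  𝒢-acyclic : GAcyclic
  𝒢-acyclic m cycle = let (v , v-firable) = firing-vertex (source-in-M cycle) in
    path-⋖ cycle v-firable v-firable ⋖-irrefl

mainTheorem13 : (n : ℕ) (_≤_ : Rel (Fin n) 0ℓ) (_∨_ _∧_ : Op₂ (Fin n)) →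
    IsLattice _≡_ _≤_ _∨_ _∧_ →
    (∃[ k ] ∃[ G ] ∃[ O ] (CFG.Acyclic {k} G × GeneratedBy _≤_ G O)) →
    OrderNotions.GAcyclic _≤_
mainTheorem13 n _≤_ _∨_ _∧_ isLattice (k , G , O , acyclic , (f , reach , surj , ord)) =
  Generated.𝒢-acyclic _≤_ _∧_ (IsLattice.isPartialOrder isLattice) (IsLattice.infimum isLattice)
                      G acyclic O f reach surj ord
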